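{- Let $k$ and $n$ be integers with $n\geqslant 9$ and $n>k \geqslant e \ln n+e$, where $e$ is Euler's number and $\ln$ is the natural logarithm. Then for every $i=1,2,\dots,n$, the number \[ S(n,i,k)=\sum_{\substack{1 \leqslant i_1<i_2<\cdots<i_k \leqslant n,\\ i_j \neq i \text{ for } j=1,2,\dots,k}} \frac{1}{i_1 i_2 \cdots i_k} \] is not an integer.
   Context: For integers $1\leqslant k<n$ and $1\leqslant i\leqslant n$, $S(n,i,k)$ denotes the $k$-th elementary symmetric function of the numbers $\{1,1/2,\dots,1/n\}\setminus\{1/i\}$, as given by the displayed sum. -}

module Defs where

open import Data.Nat as ℕ using (ℕ; zero; suc; _∸_)
open import Data.Integer using (ℤ; +_)
open import Data.Rational using (ℚ; _/_; _+_; _*_; _-_; 0ℚ; 1ℚ)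
open import Data.List using (List; []; _∷_; map; filter; upTo)
open import Relation.Nullary using (¬?)

-- k-th elementary symmetric function of a list of rationals
-- (sum over all k-element sub-multisets, by position, of the product),
-- via the standard recursion e_k(x ∷ xs) = x·e_{k-1}(xs) + e_k(xs).
esym : List ℚ → ℕ → ℚ
esym xs zero = 1ℚ
esym [] (suc k) = 0ℚ
esym (x ∷ xs) (suc k) = x * esym xs k + esym xs (suc k)

recipsExcept : ℕ → ℕ → List ℚ
recipsExcept n i =
  map (λ j → + 1 / suc j) (filter (λ j → ¬? (suc j ℕ.≟ i)) (upTo n))

S : ℕ → ℕ → ℕ → ℚ
S n i k = esym (recipsExcept n i) k

-- Σ_{j=0}^{m} 1/j!   (partial sums of e, increasing to e)
invFact : ℕ → ℚ
invFact zero = 1ℚ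
invFact (suc j) = invFact j * (+ 1 / suc j)

eApprox : ℕ → ℚ
eApprox zero = invFact zero
eApprox (suc m) = eApprox m + invFact (suc m)

-- Σ_{j=1}^{m} y^j / j with y = 1 - 1/n ; for n ≥ 1 these partial sums
-- increase to -ln(1-y) = ln n.
yOf : ℕ → ℚ
yOf n = + (n ∸ 1) / suc (n ∸ 1)   -- equals (n-1)/n when n ≥ 1

powQ : ℚ → ℕ → ℚ
powQ y zero = 1ℚ
powQ y (suc j) = y * powQ y j

lnApprox : ℕ → ℕ → ℚ
lnApprox n zero = 0ℚ
lnApprox n (suc m) = lnApprox n m + powQ (yOf n) (suc m) * (+ 1 / suc m)

-- increasing rational lower approximations of e·ln n + e = e·(ln n + 1)
-- (product of two nonnegative increasing sequences converging to e and ln n + 1)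
eLnPlusEApprox : ℕ → ℕ → ℚ
eLnPlusEApprox n m = eApprox m * (1ℚ + lnApprox n m)

-- the real-number condition  e·ln n + e ≤ k  (supremum of the approximations ≤ k)
EulerLogBound : ℕ → ℕ → Set
EulerLogBound n k = ∀ m → eLnPlusEApprox n m Data.Rational.≤ (+ k / 1)

{-# OPTIONS --safe #-}

-- S(n,i,k) = e_k(xs) for the at least n - 1 positive numbers xs = (1/j)_{j ≤ n, j ≠ i}, so S > 0
-- when k < n.  For the upper bound, k!·e_k(xs) ≤ (Σ xs)ᵏ ≤ H_nᵏ, and kᵏ ≤ k!·e^(k-1) because
-- (1 + 1/j)^j ≤ e; with e·(1 + ln n) ≤ k and H_n ≤ 1 + ln n this gives
-- S ≤ (1 + ln n)ᵏ / k! ≤ kᵏ / (eᵏ k!) ≤ 1/e < 1, and no integer lies strictly between 0 and 1.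
-- EulerLogBound only provides rational lower approximations of e and ln n; those with index n
-- suffice, since (1 + 1/j)^j ≤ eApprox j and, by Bernoulli's inequality, H_m ≤ lnApprox n m + m/n.

module Submission where

open import Data.Integer as ℤ using (ℤ; +_; -[1+_])
import Data.Integer.Solver as ℤ-Solver
open import Data.List using (List; []; _∷_; _++_; map; filter; upTo; length)
import Data.List.Properties as List
open import Data.List.Relation.Unary.All as All using (All; []; _∷_)
open import Data.List.Relation.Unary.All.Properties using (map⁺)
open import Data.Nat as ℕ using (ℕ; zero; suc; z≤n; s≤s)
import Data.Nat.Properties as ℕₚ
open import Data.Product using (∃; _,_)
open import Data.Rational
  using (ℚ; _/_; _+_; _*_; 0ℚ; 1ℚ; _≤_; _<_; toℚᵘ; positive; nonNegative)
open import Data.Rational.Properties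
import Data.Rational.Unnormalised as ℚᵘ
import Data.Rational.Unnormalised.Properties as ℚᵘₚ
import Data.Rational.Solver as ℚ-Solver
open import Level using (0ℓ)
open import Relation.Binary.PropositionalEquality
open import Relation.Nullary using (¬_; ¬?; yes; no; contradiction)
open import Relation.Unary using (Pred; Decidable)

open import Defs

private
  variable
    p q r s x y : ℚ

fromℕ : ℕ → ℚ
fromℕ n = + n / 1

1/[1+_] : ℕ → ℚ
1/[1+ j ] = + 1 / suc j

toℚᵘ-/ : ∀ a b → toℚᵘ (a / suc b) ℚᵘ.≃ ℚᵘ.mkℚᵘ a b
toℚᵘ-/ a b = toℚᵘ-fromℚᵘ (ℚᵘ.mkℚᵘ a b)

-- The cross-multiplied integer identities below are instances a = + n of ring identities:
-- + n ℤ.* + 1 does not reduce (ℕ multiplication recurses on n), so they need the ring solver.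
fromℕ-suc : ∀ n → fromℕ (suc n) ≡ fromℕ n + 1ℚ
fromℕ-suc n = toℚᵘ-injective (begin
  toℚᵘ (fromℕ (suc n))                    ≈⟨ toℚᵘ-/ (+ suc n) 0 ⟩
  ℚᵘ.mkℚᵘ (+ suc n) 0
    ≈⟨ ℚᵘ.*≡* (solve 1 (λ a → (con (+ 1) :+ a) :* con (+ 1)
                           := (a :* con (+ 1) :+ con (+ 1) :* con (+ 1)) :* con (+ 1)) refl (+ n)) ⟩
  ℚᵘ.mkℚᵘ (+ n) 0 ℚᵘ.+ ℚᵘ.mkℚᵘ (+ 1) 0    ≈⟨ ℚᵘₚ.+-cong (toℚᵘ-/ (+ n) 0) (toℚᵘ-/ (+ 1) 0) ⟨
  toℚᵘ (fromℕ n) ℚᵘ.+ toℚᵘ 1ℚ              ≈⟨ toℚᵘ-homo-+ (fromℕ n) 1ℚ ⟨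
  toℚᵘ (fromℕ n + 1ℚ)                     ∎)
  where open ℚᵘₚ.≃-Reasoning; open ℤ-Solver.+-*-Solver

fromℕ-suc*1/[1+]≡1 : ∀ j → fromℕ (suc j) * 1/[1+ j ] ≡ 1ℚ
fromℕ-suc*1/[1+]≡1 j = toℚᵘ-injective (begin
  toℚᵘ (fromℕ (suc j) * 1/[1+ j ])          ≈⟨ toℚᵘ-homo-* (fromℕ (suc j)) 1/[1+ j ] ⟩
  toℚᵘ (fromℕ (suc j)) ℚᵘ.* toℚᵘ 1/[1+ j ]  ≈⟨ ℚᵘₚ.*-cong (toℚᵘ-/ (+ suc j) 0) (toℚᵘ-/ (+ 1) j) ⟩
  ℚᵘ.mkℚᵘ (+ suc j) 0 ℚᵘ.* ℚᵘ.mkℚᵘ (+ 1) j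
    ≈⟨ ℚᵘ.*≡* (solve 1 (λ a → ((con (+ 1) :+ a) :* con (+ 1)) :* con (+ 1)
                           := con (+ 1) :* (con (+ 1) :* (con (+ 1) :+ a))) refl (+ j)) ⟩
  toℚᵘ 1ℚ                                  ∎)
  where open ℚᵘₚ.≃-Reasoning; open ℤ-Solver.+-*-Solver

n/[1+n]+1/[1+n]≡1 : ∀ n → + n / suc n + 1/[1+ n ] ≡ 1ℚ
n/[1+n]+1/[1+n]≡1 n = toℚᵘ-injective (begin
  toℚᵘ (+ n / suc n + 1/[1+ n ])            ≈⟨ toℚᵘ-homo-+ (+ n / suc n) 1/[1+ n ] ⟩
  toℚᵘ (+ n / suc n) ℚᵘ.+ toℚᵘ 1/[1+ n ]    ≈⟨ ℚᵘₚ.+-cong (toℚᵘ-/ (+ n) n) (toℚᵘ-/ (+ 1) n) ⟩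
  ℚᵘ.mkℚᵘ (+ n) n ℚᵘ.+ ℚᵘ.mkℚᵘ (+ 1) n
    ≈⟨ ℚᵘ.*≡* (solve 1 (λ a → (a :* (con (+ 1) :+ a) :+ con (+ 1) :* (con (+ 1) :+ a)) :* con (+ 1)
                           := con (+ 1) :* ((con (+ 1) :+ a) :* (con (+ 1) :+ a))) refl (+ n)) ⟩
  toℚᵘ 1ℚ                                  ∎)
  where open ℚᵘₚ.≃-Reasoning; open ℤ-Solver.+-*-Solver

0≤+m/[1+d] : ∀ m d → 0ℚ ≤ + m / suc d
0≤+m/[1+d] m d = nonNegative⁻¹ _ {{normalize-nonNeg m (suc d)}}

0<+[1+m]/[1+d] : ∀ m d → 0ℚ < + suc m / suc d
0<+[1+m]/[1+d] m d = positive⁻¹ _ {{normalize-pos (suc m) (suc d)}}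

0≤fromℕ : ∀ n → 0ℚ ≤ fromℕ n
0≤fromℕ n = 0≤+m/[1+d] n 0

0<z/1⇒1≤z/1 : ∀ z → 0ℚ < z / 1 → 1ℚ ≤ z / 1
0<z/1⇒1≤z/1 (+ zero) 0<0 = contradiction 0<0 (<-irrefl refl)
0<z/1⇒1≤z/1 (+ suc m) _ =
  toℚᵘ-cancel-≤ (ℚᵘₚ.≤-respʳ-≃ (ℚᵘₚ.≃-sym (toℚᵘ-/ (+ suc m) 0)) (ℚᵘ.*≤* (ℤ.+≤+ (s≤s z≤n))))
0<z/1⇒1≤z/1 -[1+ m ] 0<z with ℚᵘₚ.<-respʳ-≃ (toℚᵘ-/ -[1+ m ] 0) (toℚᵘ-mono-< 0<z)
... | ℚᵘ.*<* ()

*-nonNeg : 0ℚ ≤ p → 0ℚ ≤ q → 0ℚ ≤ p * q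
*-nonNeg {p} {q} 0≤p 0≤q =
  nonNegative⁻¹ (p * q) {{nonNeg*nonNeg⇒nonNeg p {{nonNegative 0≤p}} q {{nonNegative 0≤q}}}}

*-pos : 0ℚ < p → 0ℚ < q → 0ℚ < p * q
*-pos {p} {q} 0<p 0<q = positive⁻¹ (p * q) {{pos*pos⇒pos p {{positive 0<p}} q {{positive 0<q}}}}

*-monoˡ-≤-0≤ : 0ℚ ≤ r → p ≤ q → r * p ≤ r * q
*-monoˡ-≤-0≤ {r} 0≤r = *-monoˡ-≤-nonNeg r {{nonNegative 0≤r}}

*-monoʳ-≤-0≤ : 0ℚ ≤ r → p ≤ q → p * r ≤ q * r
*-monoʳ-≤-0≤ {r} 0≤r = *-monoʳ-≤-nonNeg r {{nonNegative 0≤r}}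

*-mono-≤-0≤ : 0ℚ ≤ p → 0ℚ ≤ r → p ≤ q → r ≤ s → p * r ≤ q * s
*-mono-≤-0≤ 0≤p 0≤r p≤q r≤s =
  ≤-trans (*-monoʳ-≤-0≤ 0≤r p≤q) (*-monoˡ-≤-0≤ (≤-trans 0≤p p≤q) r≤s)

p≤p+q : 0ℚ ≤ q → p ≤ p + q
p≤p+q {q} {p} 0≤q = subst (_≤ p + q) (+-identityʳ p) (+-monoʳ-≤ p 0≤q)

p≤q+p : 0ℚ ≤ q → p ≤ q + p
p≤q+p {q} {p} 0≤q = subst (_≤ q + p) (+-identityˡ p) (+-monoˡ-≤ p 0≤q)

powQ-nonNeg : ∀ t → 0ℚ ≤ y → 0ℚ ≤ powQ y t
powQ-nonNeg zero    _   = 0≤+m/[1+d] 1 0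
powQ-nonNeg (suc t) 0≤y = *-nonNeg 0≤y (powQ-nonNeg t 0≤y)

powQ-pos : ∀ t → 0ℚ < y → 0ℚ < powQ y t
powQ-pos zero    _   = 0<+[1+m]/[1+d] 0 0
powQ-pos (suc t) 0<y = *-pos 0<y (powQ-pos t 0<y)

powQ-mono-≤ : ∀ t → 0ℚ ≤ x → x ≤ y → powQ x t ≤ powQ y t
powQ-mono-≤ zero    _   _   = ≤-refl
powQ-mono-≤ (suc t) 0≤x x≤y = *-mono-≤-0≤ 0≤x (powQ-nonNeg t 0≤x) x≤y (powQ-mono-≤ t 0≤x x≤y)

powQ-distrib-* : ∀ x y t → powQ (x * y) t ≡ powQ x t * powQ y t
powQ-distrib-* x y zero    = sym (*-identityˡ 1ℚ)
powQ-distrib-* x y (suc t) = trans (cong ((x * y) *_) (powQ-distrib-* x y t))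
  (solve 4 (λ x y p q → (x :* y) :* (p :* q) := (x :* p) :* (y :* q)) refl x y (powQ x t) (powQ y t))
  where open ℚ-Solver.+-*-Solver

powQ-1 : ∀ t → powQ 1ℚ t ≡ 1ℚ
powQ-1 zero    = refl
powQ-1 (suc t) = trans (*-identityˡ _) (powQ-1 t)

binomial-two-terms≤powQ : 0ℚ ≤ x → 0ℚ ≤ y → ∀ t →
  powQ y (suc t) + fromℕ (suc t) * x * powQ y t ≤ powQ (x + y) (suc t)
binomial-two-terms≤powQ {x} {y} _ _ zero = ≤-reflexive
  (solve 2 (λ x y → y :* con 1ℚ :+ con 1ℚ :* x :* con 1ℚ := (x :+ y) :* con 1ℚ) refl x y)
  where open ℚ-Solver.+-*-Solver
binomial-two-terms≤powQ {x} {y} 0≤x 0≤y (suc t) = begin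
  y * (y * yᵗ) + fromℕ (suc (suc t)) * x * (y * yᵗ)
    ≡⟨ cong (λ c → y * (y * yᵗ) + c * x * (y * yᵗ)) (fromℕ-suc (suc t)) ⟩
  y * (y * yᵗ) + (c + 1ℚ) * x * (y * yᵗ)
    ≤⟨ p≤p+q (*-nonNeg (*-nonNeg (*-nonNeg (0≤fromℕ (suc t)) 0≤x) 0≤x) (powQ-nonNeg t 0≤y)) ⟩
  y * (y * yᵗ) + (c + 1ℚ) * x * (y * yᵗ) + c * x * x * yᵗ
    ≡⟨ solve 4 (λ y P c x → y :* (y :* P) :+ (c :+ con 1ℚ) :* x :* (y :* P) :+ c :* x :* x :* P
                := (x :+ y) :* (y :* P :+ c :* x :* P)) refl y yᵗ c x ⟩
  (x + y) * (y * yᵗ + c * x * yᵗ)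
    ≤⟨ *-monoˡ-≤-0≤ (+-mono-≤ 0≤x 0≤y) (binomial-two-terms≤powQ 0≤x 0≤y t) ⟩
  (x + y) * powQ (x + y) (suc t) ∎
  where
  open ≤-Reasoning
  open ℚ-Solver.+-*-Solver
  yᵗ = powQ y t
  c  = fromℕ (suc t)

bernoulli : y + r ≡ 1ℚ → 0ℚ ≤ y → 0ℚ ≤ r → ∀ j → 1ℚ ≤ powQ y j + fromℕ j * r
bernoulli {y} {r} _ _ _ zero =
  ≤-reflexive (sym (trans (cong (λ z → 1ℚ + z) (*-zeroˡ r)) (+-identityʳ 1ℚ)))
bernoulli {y} {r} y+r≡1 0≤y 0≤r (suc j) = begin
  1ℚ                                       ≡⟨ y+r≡1 ⟨
  y + r                                    ≤⟨ +-monoˡ-≤ r y≤ ⟩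
  y * yʲ + y * (c * r) + r                 ≤⟨ p≤p+q (*-nonNeg 0≤r (*-nonNeg (0≤fromℕ j) 0≤r)) ⟩
  y * yʲ + y * (c * r) + r + r * (c * r)
    ≡⟨ solve 4 (λ y P c r → y :* P :+ y :* (c :* r) :+ r :+ r :* (c :* r)
                := y :* P :+ (y :+ r) :* (c :* r) :+ r) refl y yʲ c r ⟩
  y * yʲ + (y + r) * (c * r) + r           ≡⟨ cong (λ z → y * yʲ + z * (c * r) + r) y+r≡1 ⟩
  y * yʲ + 1ℚ * (c * r) + r
    ≡⟨ solve 4 (λ y P c r → y :* P :+ con 1ℚ :* (c :* r) :+ r := y :* P :+ (c :+ con 1ℚ) :* r)
               refl y yʲ c r ⟩
  y * yʲ + (c + 1ℚ) * r                    ≡⟨ cong (λ z → y * yʲ + z * r) (fromℕ-suc j) ⟨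
  y * yʲ + fromℕ (suc j) * r               ∎
  where
  open ≤-Reasoning
  open ℚ-Solver.+-*-Solver
  yʲ = powQ y j
  c  = fromℕ j
  y≤ : y ≤ y * yʲ + y * (c * r)
  y≤ = begin
    y                    ≡⟨ *-identityʳ y ⟨
    y * 1ℚ               ≤⟨ *-monoˡ-≤-0≤ 0≤y (bernoulli y+r≡1 0≤y 0≤r j) ⟩
    y * (yʲ + c * r)     ≡⟨ *-distribˡ-+ y yʲ (c * r) ⟩
    y * yʲ + y * (c * r) ∎

sumQ : List ℚ → ℚ
sumQ []       = 0ℚ
sumQ (x ∷ xs) = x + sumQ xs

sumQ-++ : ∀ xs ys → sumQ (xs ++ ys) ≡ sumQ xs + sumQ ys
sumQ-++ []       ys = sym (+-identityˡ (sumQ ys))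
sumQ-++ (x ∷ xs) ys =
  trans (cong (λ z → x + z) (sumQ-++ xs ys)) (sym (+-assoc x (sumQ xs) (sumQ ys)))

sumQ-nonNeg : ∀ {xs} → All (0ℚ ≤_) xs → 0ℚ ≤ sumQ xs
sumQ-nonNeg []         = ≤-refl
sumQ-nonNeg (0≤x ∷ hs) = +-mono-≤ 0≤x (sumQ-nonNeg hs)

factorial : ℕ → ℚ
factorial zero    = 1ℚ
factorial (suc k) = fromℕ (suc k) * factorial k

factorial-pos : ∀ k → 0ℚ < factorial k
factorial-pos zero    = 0<+[1+m]/[1+d] 0 0
factorial-pos (suc k) = *-pos (0<+[1+m]/[1+d] k 0) (factorial-pos k)

esym-nonNeg : ∀ {xs} → All (0ℚ ≤_) xs → ∀ k → 0ℚ ≤ esym xs k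
esym-nonNeg _          zero    = 0≤+m/[1+d] 1 0
esym-nonNeg []         (suc k) = ≤-refl
esym-nonNeg (0≤x ∷ hs) (suc k) = +-mono-≤ (*-nonNeg 0≤x (esym-nonNeg hs k)) (esym-nonNeg hs (suc k))

esym-pos : ∀ {xs} → All (0ℚ <_) xs → ∀ k → k ℕ.≤ length xs → 0ℚ < esym xs k
esym-pos _          zero    _       = 0<+[1+m]/[1+d] 0 0
esym-pos (0<x ∷ hs) (suc k) (s≤s k≤) =
  +-mono-<-≤ (*-pos 0<x (esym-pos hs k k≤)) (esym-nonNeg (All.map <⇒≤ hs) (suc k))

factorial*esym≤sumQ^ : ∀ {xs} → All (0ℚ ≤_) xs → ∀ k →
  factorial k * esym xs k ≤ powQ (sumQ xs) k
factorial*esym≤sumQ^ _  zero = ≤-reflexive (*-identityˡ 1ℚ)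
factorial*esym≤sumQ^ [] (suc k) =
  ≤-reflexive (trans (*-zeroʳ (factorial (suc k))) (sym (*-zeroˡ (powQ 0ℚ k))))
factorial*esym≤sumQ^ {x ∷ xs} (0≤x ∷ hs) (suc k) = begin
  (c * f) * (x * e + e′)
    ≡⟨ solve 5 (λ c f x e e′ → (c :* f) :* (x :* e :+ e′) := c :* x :* (f :* e) :+ (c :* f) :* e′)
               refl c f x e e′ ⟩
  c * x * (f * e) + (c * f) * e′
    ≤⟨ +-mono-≤ (*-monoˡ-≤-0≤ (*-nonNeg (0≤fromℕ (suc k)) 0≤x) (factorial*esym≤sumQ^ hs k))
                (factorial*esym≤sumQ^ hs (suc k)) ⟩
  c * x * powQ σ k + powQ σ (suc k)
    ≡⟨ +-comm (c * x * powQ σ k) (powQ σ (suc k)) ⟩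
  powQ σ (suc k) + c * x * powQ σ k
    ≤⟨ binomial-two-terms≤powQ 0≤x (sumQ-nonNeg hs) k ⟩
  powQ (x + σ) (suc k) ∎
  where
  open ≤-Reasoning
  open ℚ-Solver.+-*-Solver
  c  = fromℕ (suc k)
  f  = factorial k
  e  = esym xs k
  e′ = esym xs (suc k)
  σ  = sumQ xs

invFact-nonNeg : ∀ t → 0ℚ ≤ invFact t
invFact-nonNeg zero    = 0≤+m/[1+d] 1 0
invFact-nonNeg (suc t) = *-nonNeg (invFact-nonNeg t) (0≤+m/[1+d] 1 t)

expTerm : ℚ → ℕ → ℚ
expTerm y t = powQ y t * invFact t

expPartial : ℚ → ℕ → ℚ
expPartial y zero    = expTerm y zero
expPartial y (suc r) = expPartial y r + expTerm y (suc r)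

expPartial-1≡eApprox : ∀ m → expPartial 1ℚ m ≡ eApprox m
expPartial-1≡eApprox zero    = *-identityˡ 1ℚ
expPartial-1≡eApprox (suc m) = cong₂ _+_ (expPartial-1≡eApprox m)
  (trans (cong (_* invFact (suc m)) (powQ-1 (suc m))) (*-identityˡ (invFact (suc m))))

eApprox-mono : ∀ {m M} → m ℕ.≤′ M → eApprox m ≤ eApprox M
eApprox-mono ℕ.≤′-refl = ≤-refl
eApprox-mono {M = suc M} (ℕ.≤′-step m≤M) =
  ≤-trans (eApprox-mono m≤M) (p≤p+q (*-nonNeg (invFact-nonNeg M) (0≤+m/[1+d] 1 M)))

expTerm-shift≤ : 0ℚ ≤ x → 0ℚ ≤ y → ∀ t →
  expTerm y (suc t) + x * expTerm y t ≤ expTerm (x + y) (suc t)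
expTerm-shift≤ {x} {y} 0≤x 0≤y t = begin
  yᵗ⁺¹ * (f * u) + x * (yᵗ * f)
    ≡⟨ cong (λ z → yᵗ⁺¹ * (f * u) + z) (trans (cong (x * (yᵗ * f) *_) (fromℕ-suc*1/[1+]≡1 t))
                                             (*-identityʳ _)) ⟨
  yᵗ⁺¹ * (f * u) + x * (yᵗ * f) * (c * u)
    ≡⟨ solve 6 (λ Y f u x P c → Y :* (f :* u) :+ x :* (P :* f) :* (c :* u)
                               := (Y :+ c :* x :* P) :* (f :* u))
               refl yᵗ⁺¹ f u x yᵗ c ⟩
  (yᵗ⁺¹ + c * x * yᵗ) * (f * u)
    ≤⟨ *-monoʳ-≤-0≤ (invFact-nonNeg (suc t)) (binomial-two-terms≤powQ 0≤x 0≤y t) ⟩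
  powQ (x + y) (suc t) * (f * u) ∎
  where
  open ≤-Reasoning
  open ℚ-Solver.+-*-Solver
  yᵗ⁺¹ = powQ y (suc t)
  yᵗ   = powQ y t
  f    = invFact t
  u    = 1/[1+ t ]
  c    = fromℕ (suc t)

expPartial-shift≤ : 0ℚ ≤ x → 0ℚ ≤ y → ∀ r →
  expPartial y (suc r) + x * expPartial y r ≤ expPartial (x + y) (suc r)
expPartial-shift≤ {x} {y} 0≤x 0≤y zero = begin
  T 0 + T 1 + x * T 0   ≡⟨ +-assoc (T 0) (T 1) (x * T 0) ⟩
  T 0 + (T 1 + x * T 0) ≤⟨ +-monoʳ-≤ (T 0) (expTerm-shift≤ 0≤x 0≤y 0) ⟩
  T 0 + expTerm (x + y) 1 ∎
  where
  open ≤-Reasoning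
  T = expTerm y
expPartial-shift≤ {x} {y} 0≤x 0≤y (suc r) = begin
  E (suc r) + T (suc (suc r)) + x * (E r + T (suc r))
    ≡⟨ solve 5 (λ a b x c d → a :+ b :+ x :* (c :+ d) := (a :+ x :* c) :+ (b :+ x :* d))
               refl (E (suc r)) (T (suc (suc r))) x (E r) (T (suc r)) ⟩
  (E (suc r) + x * E r) + (T (suc (suc r)) + x * T (suc r))
    ≤⟨ +-mono-≤ (expPartial-shift≤ 0≤x 0≤y r) (expTerm-shift≤ 0≤x 0≤y (suc r)) ⟩
  expPartial (x + y) (suc r) + expTerm (x + y) (suc (suc r)) ∎
  where
  open ≤-Reasoning
  open ℚ-Solver.+-*-Solver
  T = expTerm y
  E = expPartial y

[1+x]^m≤expPartial[mx] : 0ℚ ≤ x → ∀ m → powQ (1ℚ + x) m ≤ expPartial (fromℕ m * x) m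
[1+x]^m≤expPartial[mx] _ zero = ≤-reflexive (sym (*-identityˡ 1ℚ))
[1+x]^m≤expPartial[mx] {x} 0≤x (suc m) = begin
  (1ℚ + x) * powQ (1ℚ + x) m
    ≤⟨ *-monoˡ-≤-0≤ (+-mono-≤ (0≤+m/[1+d] 1 0) 0≤x) ([1+x]^m≤expPartial[mx] 0≤x m) ⟩
  (1ℚ + x) * E m
    ≡⟨ trans (*-distribʳ-+ (E m) 1ℚ x) (cong (_+ x * E m) (*-identityˡ (E m))) ⟩
  E m + x * E m
    ≤⟨ +-monoˡ-≤ (x * E m) (p≤p+q {p = E m} (*-nonNeg (powQ-nonNeg (suc m) 0≤mx) (invFact-nonNeg (suc m)))) ⟩
  E (suc m) + x * E m
    ≤⟨ expPartial-shift≤ 0≤x 0≤mx m ⟩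
  expPartial (x + mx) (suc m)
    ≡⟨ cong (λ z → expPartial z (suc m)) [m+1]x≡x+mx ⟨
  expPartial (fromℕ (suc m) * x) (suc m) ∎
  where
  open ≤-Reasoning
  open ℚ-Solver.+-*-Solver
  mx = fromℕ m * x
  E  = expPartial mx
  0≤mx : 0ℚ ≤ mx
  0≤mx = *-nonNeg (0≤fromℕ m) 0≤x
  [m+1]x≡x+mx : fromℕ (suc m) * x ≡ x + mx
  [m+1]x≡x+mx = trans (cong (_* x) (fromℕ-suc m))
    (solve 2 (λ a x → (a :+ con 1ℚ) :* x := x :+ a :* x) refl (fromℕ m) x)

[1+1/n]^n≤eApprox : ∀ j → powQ (1ℚ + 1/[1+ j ]) (suc j) ≤ eApprox (suc j)
[1+1/n]^n≤eApprox j = subst (powQ (1ℚ + 1/[1+ j ]) (suc j) ≤_)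
  (trans (cong (λ z → expPartial z (suc j)) (fromℕ-suc*1/[1+]≡1 j)) (expPartial-1≡eApprox (suc j)))
  ([1+x]^m≤expPartial[mx] (0≤+m/[1+d] 1 j) (suc j))

-- (k+2)^(k+1) = (k+1)^(k+1) · (1 + 1/(k+1))^(k+1), and the last factor is at most e.
[1+k]^[1+k]≤[1+k]!*e^k : ∀ M k → k ℕ.≤ M →
  powQ (fromℕ (suc k)) (suc k) ≤ factorial (suc k) * powQ (eApprox M) k
[1+k]^[1+k]≤[1+k]!*e^k M zero    _   = ≤-reflexive (sym (*-identityʳ _))
[1+k]^[1+k]≤[1+k]!*e^k M (suc k) k<M = begin
  n * powQ n (suc k)                     ≡⟨ cong (λ z → n * powQ z (suc k)) n≡m*b ⟩
  n * powQ (m * b) (suc k)               ≡⟨ cong (n *_) (powQ-distrib-* m b (suc k)) ⟩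
  n * (powQ m (suc k) * powQ b (suc k))
    ≤⟨ *-monoˡ-≤-0≤ (0≤fromℕ (suc (suc k)))
         (*-mono-≤-0≤ (powQ-nonNeg (suc k) (0≤fromℕ (suc k)))
                      (powQ-nonNeg (suc k) (+-mono-≤ (0≤+m/[1+d] 1 0) (0≤+m/[1+d] 1 k)))
                      ([1+k]^[1+k]≤[1+k]!*e^k M k (ℕₚ.<⇒≤ k<M))
                      (≤-trans ([1+1/n]^n≤eApprox k) (eApprox-mono (ℕₚ.≤⇒≤′ k<M)))) ⟩
  n * (factorial (suc k) * powQ e k * e)
    ≡⟨ solve 4 (λ n f p e → n :* (f :* p :* e) := (n :* f) :* (e :* p))
               refl n (factorial (suc k)) (powQ e k) e ⟩
  factorial (suc (suc k)) * powQ e (suc k) ∎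
  where
  open ≤-Reasoning
  open ℚ-Solver.+-*-Solver
  e = eApprox M
  n = fromℕ (suc (suc k))
  m = fromℕ (suc k)
  b = 1ℚ + 1/[1+ k ]
  n≡m*b : n ≡ m * b
  n≡m*b = trans (fromℕ-suc (suc k)) (trans (cong (λ z → m + z) (sym (fromℕ-suc*1/[1+]≡1 k)))
    (solve 2 (λ a u → a :+ a :* u := a :* (con 1ℚ :+ u)) refl m 1/[1+ k ]))

harmonic : ℕ → ℚ
harmonic n = sumQ (map 1/[1+_] (upTo n))

harmonic-suc : ∀ n → harmonic (suc n) ≡ harmonic n + 1/[1+ n ]
harmonic-suc n = begin
  sumQ (map 1/[1+_] (upTo (suc n)))             ≡⟨ cong (λ l → sumQ (map 1/[1+_] l)) (List.upTo-∷ʳ n) ⟨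
  sumQ (map 1/[1+_] (upTo n ++ n ∷ []))         ≡⟨ cong sumQ (List.map-++ 1/[1+_] (upTo n) (n ∷ [])) ⟩
  sumQ (map 1/[1+_] (upTo n) ++ 1/[1+ n ] ∷ []) ≡⟨ sumQ-++ (map 1/[1+_] (upTo n)) (1/[1+ n ] ∷ []) ⟩
  harmonic n + (1/[1+ n ] + 0ℚ)                 ≡⟨ cong (λ z → harmonic n + z) (+-identityʳ 1/[1+ n ]) ⟩
  harmonic n + 1/[1+ n ]                        ∎
  where open ≡-Reasoning

sumQ-map-filter≤ : ∀ {A : Set} {P : Pred A 0ℓ} (P? : Decidable P) {f : A → ℚ} →
  (∀ a → 0ℚ ≤ f a) → ∀ as → sumQ (map f (filter P? as)) ≤ sumQ (map f as)
sumQ-map-filter≤ P? 0≤f []       = ≤-refl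
sumQ-map-filter≤ P? {f} 0≤f (a ∷ as) with P? a
... | yes _ = +-monoʳ-≤ (f a) (sumQ-map-filter≤ P? 0≤f as)
... | no  _ = ≤-trans (sumQ-map-filter≤ P? 0≤f as) (p≤q+p (0≤f a))

lnApprox-nonNeg : ∀ n m → 0ℚ ≤ lnApprox n m
lnApprox-nonNeg n zero    = ≤-refl
lnApprox-nonNeg n (suc m) =
  +-mono-≤ (lnApprox-nonNeg n m)
           (*-nonNeg (powQ-nonNeg (suc m) (0≤+m/[1+d] (n ℕ.∸ 1) (n ℕ.∸ 1))) (0≤+m/[1+d] 1 m))

-- Bernoulli with y = 1 - 1/n gives 1/j ≤ yʲ/j + 1/n for each term of the harmonic sum.
harmonic≤lnApprox+m/n : ∀ n m → harmonic m ≤ lnApprox (suc n) m + fromℕ m * 1/[1+ n ]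
harmonic≤lnApprox+m/n n zero = ≤-reflexive (sym (trans (+-identityˡ _) (*-zeroˡ 1/[1+ n ])))
harmonic≤lnApprox+m/n n (suc m) = begin
  harmonic (suc m)                              ≡⟨ harmonic-suc m ⟩
  harmonic m + u                                ≤⟨ +-mono-≤ (harmonic≤lnApprox+m/n n m) u≤ ⟩
  (lnApprox (suc n) m + fromℕ m * a) + (Y * u + a)
    ≡⟨ solve 5 (λ l b a Y u → (l :+ b :* a) :+ (Y :* u :+ a) := (l :+ Y :* u) :+ (b :+ con 1ℚ) :* a)
               refl (lnApprox (suc n) m) (fromℕ m) a Y u ⟩
  (lnApprox (suc n) m + Y * u) + (fromℕ m + 1ℚ) * a
    ≡⟨ cong (λ z → (lnApprox (suc n) m + Y * u) + z * a) (fromℕ-suc m) ⟨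
  lnApprox (suc n) (suc m) + fromℕ (suc m) * a  ∎
  where
  open ≤-Reasoning
  open ℚ-Solver.+-*-Solver
  a = 1/[1+ n ]
  u = 1/[1+ m ]
  Y = powQ (yOf (suc n)) (suc m)
  u≤ : u ≤ Y * u + a
  u≤ = begin
    u                                   ≡⟨ *-identityˡ u ⟨
    1ℚ * u
      ≤⟨ *-monoʳ-≤-0≤ (0≤+m/[1+d] 1 m)
           (bernoulli (n/[1+n]+1/[1+n]≡1 n) (0≤+m/[1+d] n n) (0≤+m/[1+d] 1 n) (suc m)) ⟩
    (Y + fromℕ (suc m) * a) * u
      ≡⟨ solve 4 (λ Y c a u → (Y :+ c :* a) :* u := Y :* u :+ a :* (c :* u))
                 refl Y (fromℕ (suc m)) a u ⟩
    Y * u + a * (fromℕ (suc m) * u)     ≡⟨ cong (λ z → Y * u + a * z) (fromℕ-suc*1/[1+]≡1 m) ⟩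
    Y * u + a * 1ℚ                      ≡⟨ cong (λ z → Y * u + z) (*-identityʳ a) ⟩
    Y * u + a                           ∎

harmonic≤1+lnApprox : ∀ n → harmonic (suc n) ≤ 1ℚ + lnApprox (suc n) (suc n)
harmonic≤1+lnApprox n = ≤-trans (harmonic≤lnApprox+m/n n (suc n))
  (≤-reflexive (trans (cong (λ z → lnApprox (suc n) (suc n) + z) (fromℕ-suc*1/[1+]≡1 n))
                      (+-comm (lnApprox (suc n) (suc n)) 1ℚ)))

suc≢? : ∀ i → Decidable (λ j → ¬ suc j ≡ i)
suc≢? i j = ¬? (suc j ℕ.≟ i)

module _ (i : ℕ) where

  private
    kept : ℕ → ℕ
    kept n = length (filter (suc≢? i) (upTo n))

    kept-suc : ∀ n → kept (suc n) ≡ kept n ℕ.+ length (filter (suc≢? i) (n ∷ []))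
    kept-suc n = begin
      length (filter (suc≢? i) (upTo (suc n)))
                                                        ≡⟨ cong (λ l → length (filter (suc≢? i) l)) (List.upTo-∷ʳ n) ⟨
      length (filter (suc≢? i) (upTo n ++ n ∷ []))      ≡⟨ cong length (List.filter-++ (suc≢? i) (upTo n) (n ∷ [])) ⟩
      length (filter (suc≢? i) (upTo n) ++ filter (suc≢? i) (n ∷ []))
                                                        ≡⟨ List.length-++ (filter (suc≢? i) (upTo n)) ⟩
      kept n ℕ.+ length (filter (suc≢? i) (n ∷ []))     ∎
      where open ≡-Reasoning

    kept-suc-≢ : ∀ n → ¬ suc n ≡ i → kept (suc n) ≡ suc (kept n)
    kept-suc-≢ n 1+n≢i = trans (kept-suc n)
      (trans (cong (λ l → kept n ℕ.+ length l) (List.filter-accept (suc≢? i) 1+n≢i)) (ℕₚ.+-comm (kept n) 1))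

    kept-suc-≡ : ∀ n → suc n ≡ i → kept (suc n) ≡ kept n
    kept-suc-≡ n 1+n≡i = trans (kept-suc n)
      (trans (cong (λ l → kept n ℕ.+ length l) (List.filter-reject (suc≢? i) (λ ≢ → ≢ 1+n≡i)))
             (ℕₚ.+-identityʳ (kept n)))

    kept-below : ∀ n → n ℕ.< i → kept n ≡ n
    kept-below zero    _   = refl
    kept-below (suc n) n<i = trans (kept-suc-≢ n (ℕₚ.<⇒≢ n<i)) (cong suc (kept-below n (ℕₚ.<⇒≤ n<i)))

    n≤1+kept : ∀ n → n ℕ.≤ suc (kept n)
    n≤1+kept zero = z≤n
    n≤1+kept (suc n) with suc n ℕ.≟ i
    ... | yes 1+n≡i =
      s≤s (ℕₚ.≤-reflexive (sym (trans (kept-suc-≡ n 1+n≡i) (kept-below n (ℕₚ.≤-reflexive 1+n≡i)))))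
    ... | no  1+n≢i = subst (λ m → suc n ℕ.≤ suc m) (sym (kept-suc-≢ n 1+n≢i)) (s≤s (n≤1+kept n))

  n≤1+length-recipsExcept : ∀ n → n ℕ.≤ suc (length (recipsExcept n i))
  n≤1+length-recipsExcept n =
    subst (λ l → n ℕ.≤ suc l) (sym (List.length-map 1/[1+_] (filter (suc≢? i) (upTo n)))) (n≤1+kept n)

S-pos : ∀ n i k → k ℕ.< n → 0ℚ < S n i k
S-pos n i k k<n =
  esym-pos (map⁺ (All.universal (0<+[1+m]/[1+d] 0) (filter (suc≢? i) (upTo n)))) k
           (ℕₚ.≤-pred (ℕₚ.≤-trans k<n (n≤1+length-recipsExcept i n)))

powQ<factorial : ∀ {L e k} → 0ℚ < L → 1ℚ < e → e * L ≤ fromℕ (suc k) →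
  powQ (fromℕ (suc k)) (suc k) ≤ factorial (suc k) * powQ e k →
  powQ L (suc k) < factorial (suc k)
powQ<factorial {L} {e} {k} 0<L 1<e eL≤k+1 [1+k]^[1+k]≤ = begin-strict
  Lᵏ⁺¹       ≡⟨ *-identityˡ Lᵏ⁺¹ ⟨
  1ℚ * Lᵏ⁺¹  <⟨ *-monoˡ-<-pos Lᵏ⁺¹ {{positive (powQ-pos (suc k) 0<L)}} 1<e ⟩
  e * Lᵏ⁺¹   ≤⟨ *-cancelˡ-≤-pos (powQ e k) {{positive (powQ-pos k 0<e)}} eᵏ*eLᵏ⁺¹≤ ⟩
  factorial (suc k) ∎
  where
  open ≤-Reasoning
  open ℚ-Solver.+-*-Solver
  Lᵏ⁺¹ = powQ L (suc k)
  0<e : 0ℚ < e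
  0<e = <-trans (0<+[1+m]/[1+d] 0 0) 1<e
  eᵏ*eLᵏ⁺¹≤ : powQ e k * (e * Lᵏ⁺¹) ≤ powQ e k * factorial (suc k)
  eᵏ*eLᵏ⁺¹≤ = begin
    powQ e k * (e * Lᵏ⁺¹)
      ≡⟨ solve 3 (λ p e l → p :* (e :* l) := (e :* p) :* l) refl (powQ e k) e Lᵏ⁺¹ ⟩
    powQ e (suc k) * Lᵏ⁺¹                ≡⟨ powQ-distrib-* e L (suc k) ⟨
    powQ (e * L) (suc k)                 ≤⟨ powQ-mono-≤ (suc k) (*-nonNeg (<⇒≤ 0<e) (<⇒≤ 0<L)) eL≤k+1 ⟩
    powQ (fromℕ (suc k)) (suc k)         ≤⟨ [1+k]^[1+k]≤ ⟩
    factorial (suc k) * powQ e k         ≡⟨ *-comm (factorial (suc k)) (powQ e k) ⟩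
    powQ e k * factorial (suc k)         ∎

S<1 : ∀ n i k → suc k ℕ.< suc n → EulerLogBound (suc n) (suc k) → S (suc n) i (suc k) < 1ℚ
S<1 n i k k<n e[1+ln]≤k =
  *-cancelˡ-<-nonNeg k! {{nonNegative (<⇒≤ (factorial-pos (suc k)))}} (begin-strict
    k! * S (suc n) i (suc k)  ≤⟨ factorial*esym≤sumQ^ 0≤xs (suc k) ⟩
    powQ (sumQ xs) (suc k)    ≤⟨ powQ-mono-≤ (suc k) (sumQ-nonNeg 0≤xs) Σxs≤L ⟩
    powQ L (suc k)            <⟨ powQ<factorial {k = k} 0<L 1<e (e[1+ln]≤k (suc n)) kᵏ≤k!eᵏ⁻¹ ⟩
    k!                        ≡⟨ *-identityʳ k! ⟨
    k! * 1ℚ                   ∎)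
  where
  open ≤-Reasoning
  k! = factorial (suc k)
  xs = recipsExcept (suc n) i
  L  = 1ℚ + lnApprox (suc n) (suc n)
  e  = eApprox (suc n)
  0≤xs : All (0ℚ ≤_) xs
  0≤xs = map⁺ (All.universal (0≤+m/[1+d] 1) (filter (suc≢? i) (upTo (suc n))))
  Σxs≤L : sumQ xs ≤ L
  Σxs≤L = ≤-trans (sumQ-map-filter≤ (suc≢? i) (0≤+m/[1+d] 1) (upTo (suc n))) (harmonic≤1+lnApprox n)
  0<L : 0ℚ < L
  0<L = +-mono-<-≤ (0<+[1+m]/[1+d] 0 0) (lnApprox-nonNeg (suc n) (suc n))
  1<e : 1ℚ < e
  1<e = begin-strict
    1ℚ         ≡⟨ +-identityʳ 1ℚ ⟨
    1ℚ + 0ℚ    <⟨ +-monoʳ-< 1ℚ (*-pos (0<+[1+m]/[1+d] 0 0) (0<+[1+m]/[1+d] 0 0)) ⟩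
    eApprox 1  ≤⟨ eApprox-mono {1} {suc n} (ℕₚ.≤⇒≤′ (s≤s z≤n)) ⟩
    e          ∎
  kᵏ≤k!eᵏ⁻¹ : powQ (fromℕ (suc k)) (suc k) ≤ k! * powQ e k
  kᵏ≤k!eᵏ⁻¹ = [1+k]^[1+k]≤[1+k]!*e^k (suc n) k (ℕₚ.m<n⇒m≤1+n (ℕₚ.≤-pred k<n))

lemma2p3 : (n k : ℕ) → 9 ℕ.≤ n → k ℕ.< n → EulerLogBound n k →
    (i : ℕ) → 1 ℕ.≤ i → i ℕ.≤ n →
    ¬ (∃ λ (z : ℤ) → S n i k ≡ z / 1)
lemma2p3 n zero _ _ e[1+ln]≤0 _ _ _ _ = <-irrefl refl (<-≤-trans (0<+[1+m]/[1+d] 0 0) (e[1+ln]≤0 0))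
lemma2p3 zero (suc k) _ () _ _ _ _
lemma2p3 (suc n) (suc k) _ k<n e[1+ln]≤k i _ _ (z , S≡z) = <-irrefl refl (<-≤-trans z<1 1≤z)
  where
  z<1 : z / 1 < 1ℚ
  z<1 = subst (_< 1ℚ) S≡z (S<1 n i k k<n e[1+ln]≤k)
  1≤z : 1ℚ ≤ z / 1
  1≤z = 0<z/1⇒1≤z/1 z (subst (0ℚ <_) S≡z (S-pos (suc n) i (suc k) k<n))
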